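{- Let $g$ be a positive integer and $k\le\lfloor g/2\rfloor$ a nonnegative integer. Let $G=(L\cup R,E)$ be a $g$-bicycle-free bipartite graph with $n=|L|+|R|$ vertices and $|E|=m\ge n+1$ edges. Then there exist an edge $e\in E$ and $k$ distinct simple paths of length $2k$, each containing $e$, each starting at a vertex of $L$ and ending at a vertex of $L$.
   Context: A graph $G$ is $r$-bicycle-free if for every vertex $v$, the subgraph induced on the set of vertices at distance at most $r$ from $v$ contains at most one cycle. The length of a path is its number of edges. -}

module Defs where

open import Data.Nat using (ℕ; zero; suc; _+_; _*_; _≤_; _<_; _<?_)
open import Data.Nat.Properties using ()
open import Data.Fin using (Fin; zero; suc; toℕ; fromℕ; fromℕ<; inject₁; opposite)
open import Data.Bool using (Bool; true; false; _∧_; if_then_else_)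
open import Data.List using (List; map; allFin; concatMap)
open import Data.Nat.ListAction using (sum)
open import Data.Product using (Σ; ∃; ∃-syntax; _×_; _,_)
open import Data.Sum using (_⊎_)
open import Function.Definitions using (Injective)
open import Relation.Nullary using (¬_; yes; no)
open import Relation.Nullary.Decidable using (⌊_⌋)
open import Relation.Binary.PropositionalEquality using (_≡_; _≢_)

record Graph (n : ℕ) : Set where
  field
    adj     : Fin n → Fin n → Bool
    adj-sym : ∀ u w → adj u w ≡ adj w u
    adj-irr : ∀ u → adj u u ≡ false

open Graph public

Adj : ∀ {n} → Graph n → Fin n → Fin n → Set
Adj G u w = adj G u w ≡ true

edgeCount : ∀ {n} → Graph n → ℕ
edgeCount {n} G =
  sum (concatMap (λ u → map (λ w → if ⌊ toℕ u <? toℕ w ⌋ ∧ adj G u w then 1 else 0)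
                              (allFin n))
                 (allFin n))

-- G is bipartite with bipartition L = {v | side v ≡ true}, R = {v | side v ≡ false}.
IsBipartition : ∀ {n} → Graph n → (Fin n → Bool) → Set
IsBipartition G side = ∀ u w → Adj G u w → side u ≢ side w

data Walk {n} (G : Graph n) : ℕ → Fin n → Fin n → Set where
  here : ∀ {v} → Walk G zero v v
  step : ∀ {l u v w} → Adj G u v → Walk G l v w → Walk G (suc l) u w

DistLe : ∀ {n} → Graph n → ℕ → Fin n → Fin n → Set
DistLe G r v u = ∃[ l ] (l ≤ r × Walk G l v u)

next : ∀ {m} → Fin (suc m) → Fin (suc m)
next {m} i with suc (toℕ i) <? suc m
... | yes p = fromℕ< p
... | no  _ = zero

record Cycle {n} (G : Graph n) : Set where
  field
    len-3   : ℕ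
    verts   : Fin (3 + len-3) → Fin n
    injective : Injective _≡_ _≡_ verts
    closed  : ∀ i → Adj G (verts i) (verts (next i))

open Cycle public

CycleEdge : ∀ {n} {G : Graph n} → Cycle G → Fin n → Fin n → Set
CycleEdge C u w = ∃[ i ] ((verts C i ≡ u × verts C (next i) ≡ w)
                        ⊎ (verts C i ≡ w × verts C (next i) ≡ u))

-- Two cycles are the same subgraph iff they have the same edge set.
SameCycle : ∀ {n} {G : Graph n} → Cycle G → Cycle G → Set
SameCycle {n} C D = ∀ (u w : Fin n) →
  (CycleEdge C u w → CycleEdge D u w) × (CycleEdge D u w → CycleEdge C u w)

-- all vertices of the cycle lie at distance ≤ r from v
-- (so the cycle is a cycle of the subgraph induced on the ball B_r(v))
CycleInBall : ∀ {n} {G : Graph n} → ℕ → Fin n → Cycle G → Set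
CycleInBall {G = G} r v C = ∀ i → DistLe G r v (verts C i)

BicycleFree : ∀ {n} → Graph n → ℕ → Set
BicycleFree {n} G r = ∀ (v : Fin n) (C D : Cycle G) →
  CycleInBall r v C → CycleInBall r v D → SameCycle C D

record Path {n} (G : Graph n) (l : ℕ) : Set where
  field
    pv      : Fin (suc l) → Fin n
    pv-inj  : Injective _≡_ _≡_ pv
    pv-adj  : ∀ (i : Fin l) → Adj G (pv (inject₁ i)) (pv (suc i))

open Path public

PathHasEdge : ∀ {n} {G : Graph n} {l} → Path G l → Fin n → Fin n → Set
PathHasEdge {l = l} P u w = ∃[ i ] ((pv P (inject₁ i) ≡ u × pv P (suc i) ≡ w)
                                  ⊎ (pv P (inject₁ i) ≡ w × pv P (suc i) ≡ u))

SamePath : ∀ {n} {G : Graph n} {l} → Path G l → Path G l → Set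
SamePath P Q = (∀ i → pv P i ≡ pv Q i) ⊎ (∀ i → pv P i ≡ pv Q (opposite i))

startV : ∀ {n} {G : Graph n} {l} → Path G l → Fin n
startV P = pv P zero

endV : ∀ {n} {G : Graph n} {l} → Path G l → Fin n
endV {l = l} P = pv P (fromℕ l)

{-# OPTIONS --safe #-}
module Submission where

-- Deleting vertices of degree at most one keeps |E| > |V|, so some vertex set S induces a
-- subgraph of minimum degree two containing a hub x of degree at least three.  Inside S a path
-- through x grows to any length ℓ ≤ 2g by Pósa rotations.  Such a path lies in one ball of
-- radius g, so bicycle-freeness forces any two of its chords to be nested.  If no rotation
-- extends it, both ends carry chords, nesting makes the ends adjacent, and rotating x to the
-- front yields two distinct chords from x, which cannot be nested.  Finally, on a path
-- p₀ … p_{4k-1} the k windows of length 2k starting at the L-vertices among p₀ … p_{2k-1}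
-- all contain the edge p_{2k-1} p_{2k}.

open import Defs
open import Data.Nat using (ℕ; zero; suc; _+_; _*_; _∸_; _≤_; _<_; _≤?_; _<?_; z≤n; s≤s; s≤s⁻¹)
open import Data.Nat.Properties hiding (_≟_)
open import Data.Nat.Induction using (<-rec)
open import Data.Nat.ListAction using () renaming (sum to listSum)
open import Data.Nat.ListAction.Properties using (sum-++)
open import Data.Nat.DivMod using (_/_; m/n*n≤m)
open import Data.Fin using (Fin; zero; suc; toℕ; fromℕ; fromℕ<)
open import Data.Fin.Properties
  using (_≟_; any?; toℕ-injective; toℕ<n; toℕ-fromℕ; toℕ-fromℕ<; toℕ-inject₁; opposite-involutive)
open import Data.Bool using (Bool; true; false; _∧_; _∨_; not; if_then_else_)
open import Data.Bool.Properties using (¬-not; not-involutive) renaming (_≟_ to _≟ᵇ_)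
open import Data.List using (List; []; _∷_; length; concat; map; tabulate)
open import Data.List.Properties using (map-tabulate)
open import Data.List.Relation.Unary.Any using (here; there)
open import Data.Product using (Σ; ∃; ∃-syntax; _×_; _,_; proj₁; proj₂)
open import Data.Sum using (_⊎_; inj₁; inj₂)
open import Data.Empty using (⊥; ⊥-elim)
open import Function using (_∘_)
open import Relation.Nullary using (¬_; Dec; yes; no; does)
open import Relation.Nullary.Decidable using (⌊_⌋; _×-dec_; _→-dec_; ¬?; map′)
open import Relation.Binary.PropositionalEquality
open import Algebra.Properties.CommutativeMonoid.Sum +-0-commutativeMonoid
  using (sum-syntax; sum-cong-≗; ∑-distrib-+; ∑-comm; sum-replicate-zero)

χ : Bool → ℕ
χ b = if b then 1 else 0

χ-∧ : ∀ a b → χ (a ∧ b) ≡ χ a * χ b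
χ-∧ true  b = sym (+-identityʳ (χ b))
χ-∧ false b = refl

χ-∨ : ∀ a b → χ (a ∨ b) ≤ χ a + χ b
χ-∨ true  b = s≤s z≤n
χ-∨ false b = ≤-refl

∑-mono-≤ : ∀ {n} {f g : Fin n → ℕ} → (∀ i → f i ≤ g i) → ∑[ i < n ] f i ≤ ∑[ i < n ] g i
∑-mono-≤ {zero}  f≤g = z≤n
∑-mono-≤ {suc n} f≤g = +-mono-≤ (f≤g zero) (∑-mono-≤ (f≤g ∘ suc))

∑-ones : ∀ n → ∑[ i < n ] 1 ≡ n
∑-ones zero    = refl
∑-ones (suc n) = cong suc (∑-ones n)

∑-at : ∀ {n} (v : Fin n) (f : Fin n → ℕ) → ∑[ w < n ] (if does (w ≟ v) then f w else 0) ≡ f v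
∑-at {suc n} zero    f = trans (cong (f zero +_) (sum-replicate-zero n)) (+-identityʳ (f zero))
∑-at {suc n} (suc v) f = ∑-at v (f ∘ suc)

listSum-tabulate : ∀ {n} (f : Fin n → ℕ) → listSum (tabulate f) ≡ ∑[ i < n ] f i
listSum-tabulate {zero}  f = refl
listSum-tabulate {suc n} f = cong (f zero +_) (listSum-tabulate (f ∘ suc))

listSum-concat-tabulate : ∀ {n} (xs : Fin n → List ℕ) →
  listSum (concat (tabulate xs)) ≡ ∑[ i < n ] listSum (xs i)
listSum-concat-tabulate {zero}  xs = refl
listSum-concat-tabulate {suc n} xs =
  trans (sum-++ (xs zero) _) (cong (listSum (xs zero) +_) (listSum-concat-tabulate (xs ∘ suc)))

Adj-sym : ∀ {n} (G : Graph n) {u w} → Adj G u w → Adj G w u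
Adj-sym G {u} {w} uw = trans (adj-sym G w u) uw

Adj-irrefl : ∀ {n} (G : Graph n) {u} → ¬ Adj G u u
Adj-irrefl G {u} uu with trans (sym (adj-irr G u)) uu
... | ()

VertexSet : ℕ → Set
VertexSet n = Fin n → Bool

size : ∀ {n} → VertexSet n → ℕ
size {n} S = ∑[ w < n ] χ (S w)

delete : ∀ {n} → Fin n → VertexSet n → VertexSet n
delete v S w = if does (w ≟ v) then false else S w

size-delete : ∀ {n} {S : VertexSet n} {v} → S v ≡ true → size S ≡ suc (size (delete v S))
size-delete {n} {S} {v} Sv = begin
  ∑[ w < n ] χ (S w)                                ≡⟨ sum-cong-≗ split ⟩
  ∑[ w < n ] (χ (does (w ≟ v)) + χ (delete v S w))  ≡⟨ ∑-distrib-+ (χ ∘ does ∘ (_≟ v)) _ ⟩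
  ∑[ w < n ] χ (does (w ≟ v)) + size (delete v S)   ≡⟨ cong (_+ size (delete v S)) (∑-at v _) ⟩
  suc (size (delete v S))                           ∎
  where
  open ≡-Reasoning
  split : ∀ w → χ (S w) ≡ χ (does (w ≟ v)) + χ (delete v S w)
  split w with w ≟ v
  ... | yes refl = cong χ Sv
  ... | no  _    = refl

forwardEdge : ∀ {n} → Graph n → Fin n → Fin n → ℕ
forwardEdge G u w = χ (⌊ toℕ u <? toℕ w ⌋ ∧ adj G u w)

edgeCount-∑ : ∀ {n} (G : Graph n) → edgeCount G ≡ ∑[ u < n ] ∑[ w < n ] forwardEdge G u w
edgeCount-∑ {n} G = begin
  listSum (concat (map row (tabulate (λ u → u))))
    ≡⟨ cong (listSum ∘ concat) (map-tabulate (λ u → u) row) ⟩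
  listSum (concat (tabulate row))
    ≡⟨ listSum-concat-tabulate row ⟩
  ∑[ u < n ] listSum (row u)
    ≡⟨ sum-cong-≗ (λ u → cong listSum (map-tabulate (λ w → w) (forwardEdge G u))) ⟩
  ∑[ u < n ] listSum (tabulate (forwardEdge G u))
    ≡⟨ sum-cong-≗ (λ u → listSum-tabulate (forwardEdge G u)) ⟩
  ∑[ u < n ] ∑[ w < n ] forwardEdge G u w
    ∎
  where
  open ≡-Reasoning
  row : Fin n → List ℕ
  row u = map (forwardEdge G u) (tabulate (λ w → w))

χ-adj≡forward+backward : ∀ {n} (G : Graph n) u w →
  χ (adj G u w) ≡ forwardEdge G u w + forwardEdge G w u
χ-adj≡forward+backward G u w with toℕ u <? toℕ w | toℕ w <? toℕ u
... | yes u<w | yes w<u = ⊥-elim (<-asym u<w w<u)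
... | yes _   | no  _   = sym (+-identityʳ _)
... | no  _   | yes _   = cong χ (adj-sym G u w)
... | no  u≮w | no  w≮u rewrite toℕ-injective (≤-antisym (≮⇒≥ w≮u) (≮⇒≥ u≮w)) =
  cong χ (adj-irr G w)

module _ {n} (G : Graph n) where

  degree : VertexSet n → Fin n → ℕ
  degree S u = ∑[ w < n ] χ (S w ∧ adj G u w)

  degreeSum : VertexSet n → ℕ
  degreeSum S = ∑[ u < n ] (χ (S u) * degree S u)

  degree-delete : ∀ {S v} → S v ≡ true → ∀ u →
    degree S u ≡ degree (delete v S) u + χ (adj G u v)
  degree-delete {S} {v} Sv u = begin
    degree S u
      ≡⟨ sum-cong-≗ split ⟩
    ∑[ w < n ] (χ (delete v S w ∧ adj G u w) + (if does (w ≟ v) then χ (adj G u w) else 0))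
      ≡⟨ ∑-distrib-+ (λ w → χ (delete v S w ∧ adj G u w)) _ ⟩
    degree (delete v S) u + ∑[ w < n ] (if does (w ≟ v) then χ (adj G u w) else 0)
      ≡⟨ cong (degree (delete v S) u +_) (∑-at v (χ ∘ adj G u)) ⟩
    degree (delete v S) u + χ (adj G u v)
      ∎
    where
    open ≡-Reasoning
    split : ∀ w → χ (S w ∧ adj G u w)
                ≡ χ (delete v S w ∧ adj G u w) + (if does (w ≟ v) then χ (adj G u w) else 0)
    split w with w ≟ v
    ... | yes refl = cong (λ b → χ (b ∧ adj G u v)) Sv
    ... | no  _    = sym (+-identityʳ _)

  degreeSum-delete : ∀ {S v} → S v ≡ true →
    degreeSum S ≡ degreeSum (delete v S) + (degree S v + degree S v)
  degreeSum-delete {S} {v} Sv = begin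
    degreeSum S
      ≡⟨ sum-cong-≗ split ⟩
    ∑[ u < n ] (χ (S′ u) * degree S′ u + (χ (S u ∧ adj G v u) + picked u))
      ≡⟨ ∑-distrib-+ (λ u → χ (S′ u) * degree S′ u) _ ⟩
    degreeSum S′ + ∑[ u < n ] (χ (S u ∧ adj G v u) + picked u)
      ≡⟨ cong (degreeSum S′ +_) (∑-distrib-+ (λ u → χ (S u ∧ adj G v u)) _) ⟩
    degreeSum S′ + (degree S v + ∑[ u < n ] picked u)
      ≡⟨ cong (λ d → degreeSum S′ + (degree S v + d)) (∑-at v (λ _ → degree S v)) ⟩
    degreeSum S′ + (degree S v + degree S v)
      ∎
    where
    open ≡-Reasoning
    S′ = delete v S
    picked : Fin n → ℕ
    picked u = if does (u ≟ v) then degree S v else 0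
    split : ∀ u → χ (S u) * degree S u ≡ χ (S′ u) * degree S′ u + (χ (S u ∧ adj G v u) + picked u)
    split u with u ≟ v
    ... | yes refl rewrite Sv | adj-irr G v = +-identityʳ (degree S v)
    ... | no  _    = begin
      χ (S u) * degree S u
        ≡⟨ cong (χ (S u) *_) (degree-delete Sv u) ⟩
      χ (S u) * (degree S′ u + χ (adj G u v))
        ≡⟨ *-distribˡ-+ (χ (S u)) (degree S′ u) _ ⟩
      χ (S u) * degree S′ u + χ (S u) * χ (adj G u v)
        ≡⟨ cong (χ (S u) * degree S′ u +_) edge-term ⟩
      χ (S u) * degree S′ u + (χ (S u ∧ adj G v u) + 0)
        ∎
      where
      edge-term : χ (S u) * χ (adj G u v) ≡ χ (S u ∧ adj G v u) + 0
      edge-term = begin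
        χ (S u) * χ (adj G u v)  ≡⟨ χ-∧ (S u) (adj G u v) ⟨
        χ (S u ∧ adj G u v)      ≡⟨ cong (λ b → χ (S u ∧ b)) (adj-sym G u v) ⟩
        χ (S u ∧ adj G v u)      ≡⟨ +-identityʳ _ ⟨
        χ (S u ∧ adj G v u) + 0  ∎

  degreeSum-full : degreeSum (λ _ → true) ≡ edgeCount G + edgeCount G
  degreeSum-full = begin
    ∑[ u < n ] (degree (λ _ → true) u + 0)
      ≡⟨ sum-cong-≗ (λ u → +-identityʳ (degree (λ _ → true) u)) ⟩
    ∑[ u < n ] ∑[ w < n ] χ (adj G u w)
      ≡⟨ sum-cong-≗ (λ u → sum-cong-≗ (χ-adj≡forward+backward G u)) ⟩
    ∑[ u < n ] ∑[ w < n ] (forwardEdge G u w + forwardEdge G w u)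
      ≡⟨ sum-cong-≗ (λ u → ∑-distrib-+ (forwardEdge G u) (λ w → forwardEdge G w u)) ⟩
    ∑[ u < n ] (∑[ w < n ] forwardEdge G u w + ∑[ w < n ] forwardEdge G w u)
      ≡⟨ ∑-distrib-+ (λ u → ∑[ w < n ] forwardEdge G u w) _ ⟩
    E + ∑[ u < n ] ∑[ w < n ] forwardEdge G w u
      ≡⟨ cong (E +_) (∑-comm (λ w u → forwardEdge G w u)) ⟨
    E + E
      ≡⟨ cong₂ _+_ (edgeCount-∑ G) (edgeCount-∑ G) ⟨
    edgeCount G + edgeCount G
      ∎
    where
    open ≡-Reasoning
    E = ∑[ u < n ] ∑[ w < n ] forwardEdge G u w

  degreeSum-≤ : ∀ {S} → (∀ u → S u ≡ true → degree S u ≤ 2) → degreeSum S ≤ size S + size S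
  degreeSum-≤ {S} deg≤2 = ≤-trans (∑-mono-≤ bound) (≤-reflexive (∑-distrib-+ (χ ∘ S) (χ ∘ S)))
    where
    bound : ∀ u → χ (S u) * degree S u ≤ χ (S u) + χ (S u)
    bound u with S u in Su
    ... | true  = ≤-trans (≤-reflexive (+-identityʳ _)) (deg≤2 u Su)
    ... | false = z≤n

  open import Data.List.Membership.DecPropositional (_≟_ {n}) using (_∉_; _∈?_)

  membership-count : ∀ (vs : List (Fin n)) → ∑[ w < n ] χ (does (w ∈? vs)) ≤ length vs
  membership-count []       = ≤-reflexive (sum-replicate-zero n)
  membership-count (v ∷ vs) = begin
    ∑[ w < n ] χ (does (w ≟ v) ∨ does (w ∈? vs))
      ≤⟨ ∑-mono-≤ (λ w → χ-∨ (does (w ≟ v)) (does (w ∈? vs))) ⟩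
    ∑[ w < n ] (χ (does (w ≟ v)) + χ (does (w ∈? vs)))
      ≡⟨ ∑-distrib-+ (λ w → χ (does (w ≟ v))) _ ⟩
    ∑[ w < n ] χ (does (w ≟ v)) + ∑[ w < n ] χ (does (w ∈? vs))
      ≤⟨ +-mono-≤ (≤-reflexive (∑-at v (λ _ → 1))) (membership-count vs) ⟩
    suc (length vs)
      ∎
    where open ≤-Reasoning

  avoiding-neighbour : ∀ S v (avoid : List (Fin n)) → length avoid < degree S v →
    ∃ λ w → S w ≡ true × Adj G v w × w ∉ avoid
  avoiding-neighbour S v avoid avoid<deg
    with any? (λ w → S w ≟ᵇ true ×-dec adj G v w ≟ᵇ true ×-dec ¬? (w ∈? avoid))
  ... | yes found = found
  ... | no  none  = ⊥-elim (<⇒≱ avoid<deg (≤-trans (∑-mono-≤ bound) (membership-count avoid)))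
    where
    bound : ∀ w → χ (S w ∧ adj G v w) ≤ χ (does (w ∈? avoid))
    bound w with S w in Sw | adj G v w in vw | w ∈? avoid
    ... | true  | true  | no w∉ = ⊥-elim (none (w , Sw , vw , w∉))
    ... | true  | true  | yes _ = ≤-refl
    ... | true  | false | _     = z≤n
    ... | false | _     | _     = z≤n

  HasExcess : VertexSet n → Set
  HasExcess S = suc (size S) + suc (size S) ≤ degreeSum S

  excess-delete : ∀ {S v} → S v ≡ true → degree S v ≤ 1 → HasExcess S → HasExcess (delete v S)
  excess-delete {S} {v} Sv deg≤1 excess = s≤s⁻¹ (s≤s⁻¹ (begin
    suc (suc (suc s + suc s))          ≡⟨ cong suc (+-suc (suc s) (suc s)) ⟨
    suc (suc s) + suc (suc s)          ≡⟨ cong (λ m → suc m + suc m) (size-delete {S = S} Sv) ⟨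
    suc (size S) + suc (size S)        ≤⟨ excess ⟩
    degreeSum S                        ≡⟨ degreeSum-delete Sv ⟩
    degreeSum S′ + (d + d)             ≤⟨ +-monoʳ-≤ (degreeSum S′) (+-mono-≤ deg≤1 deg≤1) ⟩
    degreeSum S′ + 2                   ≡⟨ +-comm (degreeSum S′) 2 ⟩
    suc (suc (degreeSum S′))           ∎))
    where
    open ≤-Reasoning
    S′ = delete v S
    s = size S′
    d = degree S v

  record Core : Set where
    field
      vertices   : VertexSet n
      min-degree : ∀ v → vertices v ≡ true → 2 ≤ degree vertices v
      hub        : Fin n
      hub-in     : vertices hub ≡ true
      hub-degree : 3 ≤ degree vertices hub

  core : ∀ S → HasExcess S → Core
  core S = <-rec (λ c → ∀ S → size S ≡ c → HasExcess S → Core) peel (size S) S refl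
    where
    peel : ∀ c → (∀ {c′} → c′ < c → ∀ S → size S ≡ c′ → HasExcess S → Core) →
           ∀ S → size S ≡ c → HasExcess S → Core
    peel _ rec S refl excess with any? (λ v → S v ≟ᵇ true ×-dec degree S v ≤? 1)
    ... | yes (v , Sv , deg≤1) =
      rec (≤-reflexive (sym (size-delete {S = S} Sv))) (delete v S) refl
          (excess-delete Sv deg≤1 excess)
    ... | no no-leaf with any? (λ v → S v ≟ᵇ true ×-dec 3 ≤? degree S v)
    ...   | yes (v , Sv , 3≤deg) = record
      { vertices   = S
      ; min-degree = λ u Su → ≰⇒> (λ deg≤1 → no-leaf (u , Su , deg≤1))
      ; hub        = v
      ; hub-in     = Sv
      ; hub-degree = 3≤deg
      }
    ...   | no no-hub = ⊥-elim (<⇒≱ (+-mono-< (n<1+n (size S)) (n<1+n (size S)))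
                                   (≤-trans excess (degreeSum-≤ deg≤2)))
      where
      deg≤2 : ∀ u → S u ≡ true → degree S u ≤ 2
      deg≤2 u Su = ≮⇒≥ (λ 2<deg → no-hub (u , Su , 2<deg))

-- Indexing by ℕ keeps index arithmetic simple; vertex i for i > ℓ is junk.
record ℕPath {n} (G : Graph n) (ℓ : ℕ) : Set where
  field
    vertex     : ℕ → Fin n
    vertex-inj : ∀ {i j} → i ≤ ℓ → j ≤ ℓ → vertex i ≡ vertex j → i ≡ j
    vertex-adj : ∀ {i} → i < ℓ → Adj G (vertex i) (vertex (suc i))

open ℕPath

module _ {n} {G : Graph n} where

  OnPath : ∀ {ℓ} → ℕPath G ℓ → Fin n → Set
  OnPath {ℓ} P y = ∃ λ i → i ≤ ℓ × vertex P i ≡ y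

  onPath? : ∀ {ℓ} (P : ℕPath G ℓ) y → Dec (OnPath P y)
  onPath? {ℓ} P y = map′ (λ (i , i<1+ℓ , Pi≡y) → i , s≤s⁻¹ i<1+ℓ , Pi≡y)
                         (λ (i , i≤ℓ , Pi≡y) → i , s≤s i≤ℓ , Pi≡y)
                         (anyUpTo? (λ i → vertex P i ≟ y) (suc ℓ))

  prepend : ∀ {ℓ y} (P : ℕPath G ℓ) → Adj G (vertex P 0) y → ¬ OnPath P y → ℕPath G (suc ℓ)
  prepend {ℓ} {y} P P₀y y∉P = record { vertex = vertex′ ; vertex-inj = inj ; vertex-adj = adj′ }
    where
    vertex′ : ℕ → Fin n
    vertex′ zero    = y
    vertex′ (suc i) = vertex P i
    inj : ∀ {i j} → i ≤ suc ℓ → j ≤ suc ℓ → vertex′ i ≡ vertex′ j → i ≡ j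
    inj {zero}  {zero}  _   _   _  = refl
    inj {zero}  {suc j} _   j≤  eq = ⊥-elim (y∉P (j , s≤s⁻¹ j≤ , sym eq))
    inj {suc i} {zero}  i≤  _   eq = ⊥-elim (y∉P (i , s≤s⁻¹ i≤ , eq))
    inj {suc i} {suc j} i≤  j≤  eq = cong suc (vertex-inj P (s≤s⁻¹ i≤) (s≤s⁻¹ j≤) eq)
    adj′ : ∀ {i} → i < suc ℓ → Adj G (vertex′ i) (vertex′ (suc i))
    adj′ {zero}  _   = Adj-sym G P₀y
    adj′ {suc i} i<ℓ = vertex-adj P (s≤s⁻¹ i<ℓ)

m∸n≡1+m∸1+n : ∀ {m n} → n < m → m ∸ n ≡ suc (m ∸ suc n)
m∸n≡1+m∸1+n {suc m} (s≤s n≤m) = +-∸-assoc 1 n≤m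

next-spec : ∀ {m} (i : Fin (suc m)) →
  (toℕ i < m × toℕ (next i) ≡ suc (toℕ i)) ⊎ (toℕ i ≡ m × next i ≡ zero)
next-spec {m} i with suc (toℕ i) <? suc m
... | yes 1+i<1+m = inj₁ (s≤s⁻¹ 1+i<1+m , toℕ-fromℕ< 1+i<1+m)
... | no  1+i≮1+m = inj₂ (≤-antisym (s≤s⁻¹ (toℕ<n i)) (≮⇒≥ (1+i≮1+m ∘ s≤s)) , refl)

-- rot reads 0 … ℓ in the order t, t-1, …, 0, ℓ, ℓ-1, …, t+1; it is an involution of [0, ℓ].
module Rotation {ℓ t : ℕ} (t≤ℓ : t ≤ ℓ) where

  K : ℕ
  K = suc (ℓ + t)

  rot : ℕ → ℕ
  rot i with i ≤? t
  ... | yes _ = t ∸ i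
  ... | no  _ = K ∸ i

  rot-low : ∀ {i} → i ≤ t → rot i ≡ t ∸ i
  rot-low {i} i≤t with i ≤? t
  ... | yes _   = refl
  ... | no  i≰t = ⊥-elim (i≰t i≤t)

  rot-high : ∀ {i} → t < i → rot i ≡ K ∸ i
  rot-high {i} t<i with i ≤? t
  ... | yes i≤t = ⊥-elim (<⇒≱ t<i i≤t)
  ... | no  _   = refl

  K∸1+t≡ℓ : K ∸ suc t ≡ ℓ
  K∸1+t≡ℓ = m+n∸n≡m ℓ t

  t<K∸i : ∀ {i} → i ≤ ℓ → t < K ∸ i
  t<K∸i {i} i≤ℓ = begin-strict
    t                ≡⟨ m+n∸m≡n ℓ t ⟨
    ℓ + t ∸ ℓ        <⟨ n<1+n _ ⟩
    suc (ℓ + t ∸ ℓ)  ≡⟨ +-∸-assoc 1 (m≤m+n ℓ t) ⟨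
    K ∸ ℓ            ≤⟨ ∸-monoʳ-≤ K i≤ℓ ⟩
    K ∸ i            ∎
    where open ≤-Reasoning

  rot-≤ : ∀ {i} → i ≤ ℓ → rot i ≤ ℓ
  rot-≤ {i} i≤ℓ with i ≤? t
  ... | yes _   = ≤-trans (m∸n≤m t i) t≤ℓ
  ... | no  i≰t = ≤-trans (∸-monoʳ-≤ K (≰⇒> i≰t)) (≤-reflexive K∸1+t≡ℓ)

  rot-involutive : ∀ {i} → i ≤ ℓ → rot (rot i) ≡ i
  rot-involutive {i} i≤ℓ with i ≤? t
  ... | yes i≤t = trans (rot-low (m∸n≤m t i)) (m∸[m∸n]≡n i≤t)
  ... | no  _   = trans (rot-high (t<K∸i i≤ℓ)) (m∸[m∸n]≡n (m≤n⇒m≤1+n (≤-trans i≤ℓ (m≤m+n ℓ t))))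

  rot-injective : ∀ {i j} → i ≤ ℓ → j ≤ ℓ → rot i ≡ rot j → i ≡ j
  rot-injective {i} {j} i≤ℓ j≤ℓ eq =
    trans (sym (rot-involutive i≤ℓ)) (trans (cong rot eq) (rot-involutive j≤ℓ))

  rot-step : ∀ {i} → i < ℓ → rot i ≡ suc (rot (suc i)) ⊎ (i ≡ t × rot i ≡ 0 × rot (suc i) ≡ ℓ)
  rot-step {i} i<ℓ with i ≤? t | suc i ≤? t
  ... | yes _   | yes 1+i≤t = inj₁ (m∸n≡1+m∸1+n 1+i≤t)
  ... | yes i≤t | no  1+i≰t = inj₂ (i≡t , trans (cong (t ∸_) i≡t) (n∸n≡0 t) ,
                                          trans (cong (λ j → K ∸ suc j) i≡t) K∸1+t≡ℓ)
    where
    i≡t : i ≡ t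
    i≡t = ≤-antisym i≤t (s≤s⁻¹ (≰⇒> 1+i≰t))
  ... | no  i≰t | yes 1+i≤t = ⊥-elim (i≰t (<⇒≤ 1+i≤t))
  ... | no  _   | no  _     = inj₁ (m∸n≡1+m∸1+n (s≤s (≤-trans (<⇒≤ i<ℓ) (m≤m+n ℓ t))))

module _ {n} {G : Graph n} where

  -- Rotating at t = ℓ reverses the path; every other rotation passes through the edge p₀ p_ℓ.
  Rotatable : ∀ {ℓ} → ℕPath G ℓ → ℕ → Set
  Rotatable {ℓ} P t = t < ℓ → Adj G (vertex P 0) (vertex P ℓ)

  rotatable? : ∀ {ℓ} (P : ℕPath G ℓ) t → Dec (Rotatable P t)
  rotatable? {ℓ} P t = t <? ℓ →-dec adj G (vertex P 0) (vertex P ℓ) ≟ᵇ true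

  module _ {ℓ t} (P : ℕPath G ℓ) (t≤ℓ : t ≤ ℓ) (closing : Rotatable P t) where
    open Rotation t≤ℓ

    rotate : ℕPath G ℓ
    rotate = record
      { vertex     = vertex P ∘ rot
      ; vertex-inj = λ i≤ℓ j≤ℓ eq →
          rot-injective i≤ℓ j≤ℓ (vertex-inj P (rot-≤ i≤ℓ) (rot-≤ j≤ℓ) eq)
      ; vertex-adj = adj′
      }
      where
      adj′ : ∀ {i} → i < ℓ → Adj G (vertex P (rot i)) (vertex P (rot (suc i)))
      adj′ {i} i<ℓ with rot-step i<ℓ
      ... | inj₁ eq = subst (λ j → Adj G (vertex P j) (vertex P (rot (suc i)))) (sym eq)
                        (Adj-sym G (vertex-adj P (subst (_≤ ℓ) eq (rot-≤ (<⇒≤ i<ℓ)))))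
      ... | inj₂ (refl , rot-t≡0 , rot-1+t≡ℓ) =
        subst₂ (λ j k → Adj G (vertex P j) (vertex P k)) (sym rot-t≡0) (sym rot-1+t≡ℓ) (closing i<ℓ)

    rotate-start : vertex rotate 0 ≡ vertex P t
    rotate-start = cong (vertex P) (rot-low z≤n)

    onPath-rotate : ∀ {y} → OnPath P y → OnPath rotate y
    onPath-rotate (i , i≤ℓ , Pi≡y) =
      rot i , rot-≤ i≤ℓ , trans (cong (vertex P) (rot-involutive i≤ℓ)) Pi≡y

    onPath-unrotate : ∀ {y} → OnPath rotate y → OnPath P y
    onPath-unrotate (i , i≤ℓ , eq) = rot i , rot-≤ i≤ℓ , eq

  walk-forward : ∀ {ℓ} (P : ℕPath G ℓ) d i → d + i ≤ ℓ → Walk G d (vertex P i) (vertex P (d + i))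
  walk-forward P zero    i _   = here
  walk-forward P (suc d) i d+i<ℓ =
    step (vertex-adj P (≤-trans (s≤s (m≤n+m i d)) d+i<ℓ))
         (subst (Walk G d (vertex P (suc i)) ∘ vertex P) (+-suc d i)
                (walk-forward P d (suc i) (≤-trans (≤-reflexive (+-suc d i)) d+i<ℓ)))

  walk-backward : ∀ {ℓ} (P : ℕPath G ℓ) d i → d + i ≤ ℓ → Walk G d (vertex P (d + i)) (vertex P i)
  walk-backward P zero    i _     = here
  walk-backward P (suc d) i d+i<ℓ =
    step (Adj-sym G (vertex-adj P d+i<ℓ)) (walk-backward P d i (<⇒≤ d+i<ℓ))

  within-ball : ∀ {ℓ g} (P : ℕPath G ℓ) → ℓ ≤ g + g → ∀ {i} → i ≤ ℓ →
    DistLe G g (vertex P (ℓ ∸ g)) (vertex P i)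
  within-ball {ℓ} {g} P ℓ≤2g {i} i≤ℓ with ℓ ∸ g ≤? i
  ... | yes c≤i = i ∸ c , i∸c≤g ,
          subst (Walk G (i ∸ c) (vertex P c) ∘ vertex P) (m∸n+n≡m c≤i)
                (walk-forward P (i ∸ c) c (≤-trans (≤-reflexive (m∸n+n≡m c≤i)) i≤ℓ))
    where
    c = ℓ ∸ g
    i∸c≤g : i ∸ c ≤ g
    i∸c≤g = begin
      i ∸ c        ≤⟨ ∸-monoˡ-≤ c i≤ℓ ⟩
      ℓ ∸ c        ≤⟨ ∸-monoˡ-≤ c (m≤n+m∸n ℓ g) ⟩
      g + c ∸ c    ≡⟨ m+n∸n≡m g c ⟩
      g            ∎
      where open ≤-Reasoning
  ... | no c≰i = c ∸ i , ≤-trans (m∸n≤m c i) c≤g ,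
          subst (λ j → Walk G (c ∸ i) (vertex P j) (vertex P i)) (m∸n+n≡m i≤c)
                (walk-backward P (c ∸ i) i (≤-trans (≤-reflexive (m∸n+n≡m i≤c)) (m∸n≤m ℓ g)))
    where
    c = ℓ ∸ g
    i≤c = <⇒≤ (≰⇒> c≰i)
    c≤g : c ≤ g
    c≤g = ≤-trans (∸-monoˡ-≤ g ℓ≤2g) (≤-reflexive (m+n∸n≡m g g))

  record Chord {ℓ} (P : ℕPath G ℓ) (a b : ℕ) : Set where
    constructor chord
    field
      gap≥2    : 2 + a ≤ b
      end≤ℓ    : b ≤ ℓ
      adjacent : Adj G (vertex P a) (vertex P b)

  module _ {ℓ a b} (P : ℕPath G ℓ) (c : Chord P a b) where
    open Chord c

    private
      d : ℕ
      d = b ∸ (2 + a)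

      span : 2 + d + a ≡ b
      span = trans (cong (_+ a) (+-comm 2 d)) (trans (+-assoc d 2 a) (m∸n+n≡m gap≥2))

      index≤b : ∀ (i : Fin (3 + d)) → toℕ i + a ≤ b
      index≤b i = ≤-trans (+-monoˡ-≤ a (s≤s⁻¹ (toℕ<n i))) (≤-reflexive span)

      index≤ℓ : ∀ (i : Fin (3 + d)) → toℕ i + a ≤ ℓ
      index≤ℓ i = ≤-trans (index≤b i) end≤ℓ

    chordCycle : Cycle G
    chordCycle = record
      { len-3     = d
      ; verts     = λ i → vertex P (toℕ i + a)
      ; injective = λ {i} {j} eq →
          toℕ-injective (+-cancelʳ-≡ _ _ _ (vertex-inj P (index≤ℓ i) (index≤ℓ j) eq))
      ; closed    = consecutive-adjacent
      }
      where
      consecutive-adjacent : ∀ i → Adj G (vertex P (toℕ i + a)) (vertex P (toℕ (next i) + a))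
      consecutive-adjacent i with next-spec i
      ... | inj₁ (i<2+d , next≡) rewrite next≡ =
        vertex-adj P (≤-trans (+-monoˡ-≤ a i<2+d) (≤-trans (≤-reflexive span) end≤ℓ))
      ... | inj₂ (i≡2+d , next≡0) rewrite next≡0 =
        subst (λ j → Adj G (vertex P j) (vertex P a)) (sym (trans (cong (_+ a) i≡2+d) span))
              (Adj-sym G adjacent)

    chordCycle-closing : CycleEdge chordCycle (vertex P b) (vertex P a)
    chordCycle-closing = fromℕ (2 + d) , inj₁ (cong (vertex P) last , wrap)
      where
      last : toℕ (fromℕ (2 + d)) + a ≡ b
      last = trans (cong (_+ a) (toℕ-fromℕ (2 + d))) span
      wrap : vertex P (toℕ (next (fromℕ (2 + d))) + a) ≡ vertex P a
      wrap with next-spec (fromℕ (2 + d))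
      ... | inj₁ (last<2+d , _) = ⊥-elim (<-irrefl (toℕ-fromℕ (2 + d)) last<2+d)
      ... | inj₂ (_ , next≡0)   = cong (λ j → vertex P (toℕ j + a)) next≡0

    chordCycle-range : ∀ i {j} → j ≤ ℓ → verts chordCycle i ≡ vertex P j → a ≤ j × j ≤ b
    chordCycle-range i j≤ℓ eq with vertex-inj P (index≤ℓ i) j≤ℓ eq
    ... | refl = m≤n+m a (toℕ i) , index≤b i

    chordCycle-in-ball : ∀ {g} → ℓ ≤ g + g → CycleInBall g (vertex P (ℓ ∸ g)) chordCycle
    chordCycle-in-ball ℓ≤2g i = within-ball P ℓ≤2g (index≤ℓ i)

  cycleEdge-ends : ∀ (C : Cycle G) {u w} → CycleEdge C u w →
    (∃ λ i → verts C i ≡ u) × (∃ λ i → verts C i ≡ w)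
  cycleEdge-ends C (i , inj₁ (Ci≡u , Cnext≡w)) = (i , Ci≡u) , (next i , Cnext≡w)
  cycleEdge-ends C (i , inj₂ (Ci≡w , Cnext≡u)) = (next i , Cnext≡u) , (i , Ci≡w)

  -- Both chord cycles lie in one ball of radius g, so they have the same edges; in particular
  -- the closing edge of the first lies on the second.
  chords-nested : ∀ {g ℓ} → BicycleFree G g → ℓ ≤ g + g → (P : ℕPath G ℓ) →
    ∀ {a b a′ b′} → Chord P a b → Chord P a′ b′ → a′ ≤ a × b ≤ b′
  chords-nested {ℓ = ℓ} bf ℓ≤2g P {a} {b} c c′ =
    let (i , C′i≡b) , (j , C′j≡a) = cycleEdge-ends (chordCycle P c′) shared
    in  proj₁ (chordCycle-range P c′ j a≤ℓ C′j≡a) , proj₂ (chordCycle-range P c′ i (end≤ℓ c) C′i≡b)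
    where
    open Chord
    shared : CycleEdge (chordCycle P c′) (vertex P b) (vertex P a)
    shared = proj₁ (bf _ (chordCycle P c) (chordCycle P c′)
                          (chordCycle-in-ball P c ℓ≤2g) (chordCycle-in-ball P c′ ℓ≤2g) _ _)
                   (chordCycle-closing P c)
    a≤ℓ : a ≤ ℓ
    a≤ℓ = ≤-trans (m≤n+m a 2) (≤-trans (gap≥2 c) (end≤ℓ c))

2+m≤n : ∀ {m n} → m ≤ n → m ≢ n → m ≢ n ∸ 1 → 2 + m ≤ n
2+m≤n {m} {zero}  z≤n m≢n _ = ⊥-elim (m≢n refl)
2+m≤n {m} {suc n} m≤1+n m≢1+n m≢n = s≤s (≤∧≢⇒< (s≤s⁻¹ (≤∧≢⇒< m≤1+n m≢1+n)) m≢n)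

2≤n : ∀ {n} → n ≢ 0 → n ≢ 1 → 2 ≤ n
2≤n {zero}        n≢0 _   = ⊥-elim (n≢0 refl)
2≤n {suc zero}    _   n≢1 = ⊥-elim (n≢1 refl)
2≤n {suc (suc n)} _   _   = s≤s (s≤s z≤n)

module Saturation {n} {G : Graph n} {g} (bf : BicycleFree G g) (S : VertexSet n) where

  open import Data.List.Membership.DecPropositional (_≟_ {n}) using (_∉_)

  Escape : ∀ {ℓ} → ℕPath G ℓ → ℕ → Set
  Escape P t = ∃ λ y → S y ≡ true × Adj G (vertex P t) y × ¬ OnPath P y

  escape? : ∀ {ℓ} (P : ℕPath G ℓ) t → Dec (Escape P t)
  escape? P t = any? (λ y → S y ≟ᵇ true ×-dec adj G (vertex P t) y ≟ᵇ true ×-dec ¬? (onPath? P y))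

  Saturated : ∀ {ℓ} → ℕPath G ℓ → ℕ → Set
  Saturated P t = ∀ y → S y ≡ true → Adj G (vertex P t) y → OnPath P y

  saturated : ∀ {ℓ} (P : ℕPath G ℓ) {t} → ¬ Escape P t → Saturated P t
  saturated P no-escape y Sy Pt~y with onPath? P y
  ... | yes y∈P = y∈P
  ... | no  y∉P = ⊥-elim (no-escape (y , Sy , Pt~y , y∉P))

  end-chord : ∀ {ℓ} (P : ℕPath G ℓ) → 2 ≤ degree G S (vertex P ℓ) → Saturated P ℓ →
    ∃ λ i → Chord P i ℓ
  end-chord {ℓ} P deg≥2 sat with avoiding-neighbour G S (vertex P ℓ) (vertex P (ℓ ∸ 1) ∷ []) deg≥2
  ... | w , Sw , Pℓ~w , w∉ with sat w Sw Pℓ~w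
  ... | i , i≤ℓ , refl =
    i , chord (2+m≤n i≤ℓ i≢ℓ (w∉ ∘ here ∘ cong (vertex P))) ≤-refl (Adj-sym G Pℓ~w)
    where
    i≢ℓ : i ≢ ℓ
    i≢ℓ refl = Adj-irrefl G Pℓ~w

  start-chord : ∀ {ℓ} (P : ℕPath G ℓ) → Saturated P 0 → ∀ avoid →
    suc (length avoid) < degree G S (vertex P 0) → ∃ λ j → Chord P 0 j × vertex P j ∉ avoid
  start-chord P sat avoid long with avoiding-neighbour G S (vertex P 0) (vertex P 1 ∷ avoid) long
  ... | w , Sw , P₀~w , w∉ with sat w Sw P₀~w
  ... | j , j≤ℓ , refl = j , chord (2≤n j≢0 (w∉ ∘ here ∘ cong (vertex P))) j≤ℓ P₀~w , w∉ ∘ there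
    where
    j≢0 : j ≢ 0
    j≢0 refl = Adj-irrefl G P₀~w

  ends-adjacent : ∀ {ℓ} → ℓ ≤ g + g → (P : ℕPath G ℓ) →
    2 ≤ degree G S (vertex P 0) → 2 ≤ degree G S (vertex P ℓ) →
    Saturated P 0 → Saturated P ℓ → Adj G (vertex P 0) (vertex P ℓ)
  ends-adjacent ℓ≤2g P deg₀≥2 degℓ≥2 sat₀ satℓ
    with end-chord P degℓ≥2 satℓ | start-chord P sat₀ [] deg₀≥2
  ... | _ , end | j , start , _ = subst (Adj G (vertex P 0) ∘ vertex P) j≡ℓ (Chord.adjacent start)
    where
    j≡ℓ = ≤-antisym (Chord.end≤ℓ start) (proj₂ (chords-nested bf ℓ≤2g P end start))

  start-unsaturated : ∀ {ℓ} → ℓ ≤ g + g → (P : ℕPath G ℓ) → 3 ≤ degree G S (vertex P 0) →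
    ¬ Saturated P 0
  start-unsaturated ℓ≤2g P deg≥3 sat with start-chord P sat [] (≤-trans (n≤1+n 2) deg≥3)
  ... | j₁ , c₁ , _ with start-chord P sat (vertex P j₁ ∷ []) deg≥3
  ... | j₂ , c₂ , j₂∉ = j₂∉ (here (cong (vertex P) j₂≡j₁))
    where
    j₂≡j₁ = ≤-antisym (proj₂ (chords-nested bf ℓ≤2g P c₂ c₁))
                      (proj₂ (chords-nested bf ℓ≤2g P c₁ c₂))

module Growth {n} {G : Graph n} {g} (bf : BicycleFree G g) (C : Core G) where

  open Core C renaming (vertices to S)
  open Saturation bf S

  record Grown (ℓ : ℕ) : Set where
    field
      path    : ℕPath G ℓ
      inside  : ∀ {i} → i ≤ ℓ → S (vertex path i) ≡ true
      has-hub : OnPath path hub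

  open Grown

  extend-at-start : ∀ {ℓ} (γ : Grown ℓ) → Escape (path γ) 0 → Grown (suc ℓ)
  extend-at-start γ (y , Sy , P₀~y , y∉P) = record
    { path    = prepend (path γ) P₀~y y∉P
    ; inside  = λ { {zero} _ → Sy ; {suc i} 1+i≤1+ℓ → inside γ (s≤s⁻¹ 1+i≤1+ℓ) }
    ; has-hub = let i , i≤ℓ , Pi≡hub = has-hub γ in suc i , s≤s i≤ℓ , Pi≡hub
    }

  extend-after-rotation : ∀ {ℓ t} (γ : Grown ℓ) (t≤ℓ : t ≤ ℓ) (closing : Rotatable (path γ) t) →
    Escape (path γ) t → Grown (suc ℓ)
  extend-after-rotation γ t≤ℓ closing (y , Sy , Pt~y , y∉P) = extend-at-start γ′ escape′
    where
    P′ = rotate (path γ) t≤ℓ closing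
    γ′ = record
      { path    = P′
      ; inside  = λ i≤ℓ → inside γ (Rotation.rot-≤ t≤ℓ i≤ℓ)
      ; has-hub = onPath-rotate (path γ) t≤ℓ closing (has-hub γ)
      }
    escape′ : Escape P′ 0
    escape′ = y , Sy , subst (λ v → Adj G v y) (sym (rotate-start (path γ) t≤ℓ closing)) Pt~y ,
              y∉P ∘ onPath-unrotate (path γ) t≤ℓ closing

  saturated-rotations-impossible : ∀ {ℓ} → ℓ ≤ g + g → (γ : Grown ℓ) → Saturated (path γ) 0 →
    (∀ {t} → t ≤ ℓ → Rotatable (path γ) t → Saturated (path γ) t) → ⊥
  saturated-rotations-impossible {ℓ} ℓ≤2g γ sat₀ sat-rotatable with has-hub γ
  ... | a , a≤ℓ , Pa≡hub = start-unsaturated ℓ≤2g P′ deg≥3 sat′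
    where
    P = path γ
    closing : Adj G (vertex P 0) (vertex P ℓ)
    closing = ends-adjacent ℓ≤2g P (min-degree _ (inside γ z≤n)) (min-degree _ (inside γ ≤-refl))
                sat₀ (sat-rotatable ≤-refl (λ ℓ<ℓ → ⊥-elim (<-irrefl refl ℓ<ℓ)))
    P′ = rotate P a≤ℓ (λ _ → closing)
    P′₀≡Pa : vertex P′ 0 ≡ vertex P a
    P′₀≡Pa = rotate-start P a≤ℓ (λ _ → closing)
    deg≥3 : 3 ≤ degree G S (vertex P′ 0)
    deg≥3 = subst (λ v → 3 ≤ degree G S v) (sym (trans P′₀≡Pa Pa≡hub)) hub-degree
    sat′ : Saturated P′ 0
    sat′ y Sy P′₀~y = onPath-rotate P a≤ℓ (λ _ → closing)
      (sat-rotatable a≤ℓ (λ _ → closing) y Sy (subst (λ v → Adj G v y) P′₀≡Pa P′₀~y))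

  extend : ∀ {ℓ} → ℓ ≤ g + g → Grown ℓ → Grown (suc ℓ)
  extend {ℓ} ℓ≤2g γ with escape? (path γ) 0
  ... | yes escape₀ = extend-at-start γ escape₀
  ... | no  stuck₀ with anyUpTo? (λ t → rotatable? (path γ) t ×-dec escape? (path γ) t) (suc ℓ)
  ...   | yes (t , t<1+ℓ , closing , escapeₜ) =
    extend-after-rotation γ (s≤s⁻¹ t<1+ℓ) closing escapeₜ
  ...   | no  stuck = ⊥-elim (saturated-rotations-impossible ℓ≤2g γ (saturated (path γ) stuck₀)
                                (λ {t} t≤ℓ closing → saturated (path γ) λ escapeₜ →
                                   stuck (t , s≤s t≤ℓ , closing , escapeₜ)))

  grow : ∀ ℓ → ℓ ≤ g + g → Grown ℓ
  grow zero    _        = record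
    { path    = record { vertex = λ _ → hub ; vertex-inj = λ { z≤n z≤n _ → refl }
                       ; vertex-adj = λ () }
    ; inside  = λ _ → hub-in
    ; has-hub = 0 , z≤n , refl
    }
  grow (suc ℓ) 1+ℓ≤2g = extend (<⇒≤ 1+ℓ≤2g) (grow ℓ (<⇒≤ 1+ℓ≤2g))

long-path : ∀ {n g} (G : Graph n) → BicycleFree G g → suc n ≤ edgeCount G →
  ∀ ℓ → ℓ ≤ g + g → ℕPath G ℓ
long-path {n} G bf dense ℓ ℓ≤2g = Grown.path (grow ℓ ℓ≤2g)
  where
  excess : HasExcess G (λ _ → true)
  excess = subst₂ (λ s D → suc s + suc s ≤ D) (sym (∑-ones n)) (sym (degreeSum-full G))
                  (+-mono-≤ dense dense)
  open Growth bf (core G (λ _ → true) excess)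

module _ {n} {G : Graph n} where

  subpath : ∀ {ℓ} (P : ℕPath G ℓ) s m → m + s ≤ ℓ → Path G m
  subpath {ℓ} P s m m+s≤ℓ = record
    { pv     = λ j → vertex P (toℕ j + s)
    ; pv-inj = λ {i} {j} eq →
        toℕ-injective (+-cancelʳ-≡ s _ _ (vertex-inj P (index≤ℓ i) (index≤ℓ j) eq))
    ; pv-adj = λ i →
        subst (λ k → Adj G (vertex P (k + s)) (vertex P (suc (toℕ i + s)))) (sym (toℕ-inject₁ i))
              (vertex-adj P (≤-trans (+-monoˡ-≤ s (toℕ<n i)) m+s≤ℓ))
    }
    where
    index≤ℓ : ∀ (j : Fin (suc m)) → toℕ j + s ≤ ℓ
    index≤ℓ j = ≤-trans (+-monoˡ-≤ s (s≤s⁻¹ (toℕ<n j))) m+s≤ℓ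

  subpath-injective : ∀ {ℓ} (P : ℕPath G ℓ) {s s′ m} (fits : m + s ≤ ℓ) (fits′ : m + s′ ≤ ℓ) →
    SamePath (subpath P s m fits) (subpath P s′ m fits′) → s ≡ s′
  subpath-injective P {m = m} fits fits′ (inj₁ same) =
    vertex-inj P (≤-trans (m≤n+m _ m) fits) (≤-trans (m≤n+m _ m) fits′) (same zero)
  subpath-injective P {s} {s′} {m} fits fits′ (inj₂ reversed) =
    ≤-antisym (subst (s ≤_) m+s≡s′ (m≤n+m s m)) (subst (s′ ≤_) (sym s≡m+s′) (m≤n+m s′ m))
    where
    s≡m+s′ : s ≡ m + s′
    s≡m+s′ = vertex-inj P (≤-trans (m≤n+m s m) fits) fits′
               (trans (reversed zero) (cong (λ k → vertex P (k + s′)) (toℕ-fromℕ m)))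
    m+s≡s′ : m + s ≡ s′
    m+s≡s′ = vertex-inj P fits (≤-trans (m≤n+m s′ m) fits′)
               (trans (cong (λ k → vertex P (k + s)) (sym (toℕ-fromℕ m)))
                      (trans (reversed (fromℕ m))
                             (cong (λ j → vertex P (toℕ j + s′)) (opposite-involutive zero))))

  subpath-has-edge : ∀ {ℓ} (P : ℕPath G ℓ) {s m e} (fits : m + s ≤ ℓ) → s ≤ e → e < m + s →
    PathHasEdge (subpath P s m fits) (vertex P e) (vertex P (suc e))
  subpath-has-edge P {s} {m} {e} fits s≤e e<m+s =
    fromℕ< e∸s<m , inj₁ (cong (vertex P) (trans (cong (_+ s) (toℕ-inject₁ _)) offset) ,
                         cong (vertex P ∘ suc) offset)
    where
    e∸s<m : e ∸ s < m
    e∸s<m = ≤-trans (∸-monoˡ-< e<m+s s≤e) (≤-reflexive (m+n∸n≡m m s))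
    offset : toℕ (fromℕ< e∸s<m) + s ≡ e
    offset = trans (cong (_+ s) (toℕ-fromℕ< e∸s<m)) (m∸n+n≡m s≤e)

module _ {n} {G : Graph n} {side : Fin n → Bool} (bip : IsBipartition G side) where

  side-step : ∀ {ℓ} (P : ℕPath G ℓ) {i} → i < ℓ → side (vertex P (suc i)) ≡ not (side (vertex P i))
  side-step P i<ℓ = ¬-not (λ eq → bip _ _ (vertex-adj P i<ℓ) (sym eq))

  side-even : ∀ {ℓ} (P : ℕPath G ℓ) d i → d * 2 + i ≤ ℓ →
    side (vertex P (d * 2 + i)) ≡ side (vertex P i)
  side-even P zero    i _  = refl
  side-even P (suc d) i le = begin
    side (vertex P (suc (suc (d * 2 + i))))   ≡⟨ side-step P le ⟩
    not (side (vertex P (suc (d * 2 + i))))   ≡⟨ cong not (side-step P (<⇒≤ le)) ⟩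
    not (not (side (vertex P (d * 2 + i))))   ≡⟨ not-involutive _ ⟩
    side (vertex P (d * 2 + i))               ≡⟨ side-even P d i (<⇒≤ (<⇒≤ le)) ⟩
    side (vertex P i)                         ∎
    where open ≡-Reasoning

  side-true-near-start : ∀ {ℓ} (P : ℕPath G ℓ) → 0 < ℓ → ∃ λ b → b ≤ 1 × side (vertex P b) ≡ true
  side-true-near-start P 0<ℓ with side (vertex P 0) in side₀
  ... | true  = 0 , z≤n , side₀
  ... | false = 1 , ≤-refl , trans (side-step P 0<ℓ) (cong not side₀)

SharedEdgePaths : ∀ {n} → Graph n → (Fin n → Bool) → ℕ → Set
SharedEdgePaths G side k =
  ∃[ u ] ∃[ w ] (Adj G u w ×
    Σ (Fin k → Path G (2 * k)) (λ P →
      (∀ i j → i ≢ j → ¬ SamePath (P i) (P j)) ×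
      (∀ i → PathHasEdge (P i) u w × side (startV (P i)) ≡ true × side (endV (P i)) ≡ true)))

k*2+1<2*[1+k] : ∀ k → k * 2 + 1 < 2 * suc k
k*2+1<2*[1+k] k = ≤-reflexive (trans (cong suc (+-comm (k * 2) 1)) (*-comm (suc k) 2))

shared-edge-windows : ∀ {n} {G : Graph n} {side} → IsBipartition G side → ∀ k →
  ℕPath G (2 * suc k + (k * 2 + 1)) → SharedEdgePaths G side (suc k)
shared-edge-windows {G = G} {side} bip k P with side-true-near-start bip P (s≤s z≤n)
... | b , b≤1 , side-b =
  vertex P e , vertex P (suc e) , vertex-adj P (≤-trans e<m (m≤m+n m e)) ,
  window , windows-distinct , λ i → window-has-edge i , side-start i , side-end i
  where
  m = 2 * suc k
  e = k * 2 + 1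
  e<m = k*2+1<2*[1+k] k
  m≡[1+k]*2 = *-comm 2 (suc k)

  start : Fin (suc k) → ℕ
  start i = toℕ i * 2 + b

  start≤e : ∀ i → start i ≤ e
  start≤e i = +-mono-≤ (*-monoˡ-≤ 2 (s≤s⁻¹ (toℕ<n i))) b≤1

  fits : ∀ i → m + start i ≤ m + e
  fits i = +-monoʳ-≤ m (start≤e i)

  window : Fin (suc k) → Path G m
  window i = subpath P (start i) m (fits i)

  windows-distinct : ∀ i j → i ≢ j → ¬ SamePath (window i) (window j)
  windows-distinct i j i≢j same =
    i≢j (toℕ-injective (*-cancelʳ-≡ (toℕ i) (toℕ j) 2
          (+-cancelʳ-≡ b _ _ (subpath-injective P (fits i) (fits j) same))))

  window-has-edge : ∀ i → PathHasEdge (window i) (vertex P e) (vertex P (suc e))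
  window-has-edge i = subpath-has-edge P (fits i) (start≤e i) (≤-trans e<m (m≤m+n m (start i)))

  side-start : ∀ i → side (vertex P (start i)) ≡ true
  side-start i = trans (side-even bip P (toℕ i) b (≤-trans (m≤n+m (start i) m) (fits i))) side-b

  side-end : ∀ i → side (vertex P (toℕ (fromℕ m) + start i)) ≡ true
  side-end i = begin
    side (vertex P (toℕ (fromℕ m) + start i))
      ≡⟨ cong (λ j → side (vertex P (j + start i))) (trans (toℕ-fromℕ m) m≡[1+k]*2) ⟩
    side (vertex P (suc k * 2 + start i))
      ≡⟨ side-even bip P (suc k) (start i) (subst (λ j → j + start i ≤ m + e) m≡[1+k]*2 (fits i)) ⟩
    side (vertex P (start i))
      ≡⟨ side-start i ⟩
    true
      ∎
    where open ≡-Reasoning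

mainTheorem12 : (g k n : ℕ) (G : Graph n) (side : Fin n → Bool) →
    1 ≤ g → k ≤ g / 2 →
    IsBipartition G side →
    BicycleFree G g →
    suc n ≤ edgeCount G →
    ∃[ u ] ∃[ w ] (Adj G u w ×
      Σ (Fin k → Path G (2 * k)) (λ P →
        (∀ i j → i ≢ j → ¬ SamePath (P i) (P j)) ×
        (∀ i → PathHasEdge (P i) u w
             × side (startV (P i)) ≡ true
             × side (endV (P i)) ≡ true)))
mainTheorem12 g zero n G side 1≤g _ _ bf dense =
  vertex P 0 , vertex P 1 , vertex-adj P (s≤s z≤n) , (λ ()) , (λ ()) , (λ ())
  where
  P = long-path G bf dense 1 (≤-trans 1≤g (m≤m+n g g))
mainTheorem12 g (suc k) n G side _ 1+k≤g/2 bip bf dense =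
  shared-edge-windows bip k (long-path G bf dense _ length≤2g)
  where
  2[1+k]≤g : 2 * suc k ≤ g
  2[1+k]≤g = begin
    2 * suc k    ≡⟨ *-comm 2 (suc k) ⟩
    suc k * 2    ≤⟨ *-monoˡ-≤ 2 1+k≤g/2 ⟩
    g / 2 * 2    ≤⟨ m/n*n≤m g 2 ⟩
    g            ∎
    where open ≤-Reasoning
  length≤2g : 2 * suc k + (k * 2 + 1) ≤ g + g
  length≤2g = +-mono-≤ 2[1+k]≤g (≤-trans (<⇒≤ (k*2+1<2*[1+k] k)) 2[1+k]≤g)
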